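{- Let $\mathcal{F}$ be a filter on $\omega$. The game $\mathfrak{G}(\mathcal{F}^+,[\omega]^{<\omega},\mathcal{F}^c)$ is dual to the game $\mathfrak{G}(\mathcal{F},\omega,\mathcal{F})$. Therefore, in $\mathfrak{G}(\mathcal{F}^+,[\omega]^{<\omega},\mathcal{F}^c)$: (1) player I never has a winning strategy; (2) player II has a winning strategy if and only if $\mathcal{F}$ is not a Ramsey filter.
   Context: A filter on $\omega$ is a family $\mathcal{F}\subseteq\mathcal{P}(\omega)$ closed under finite intersections and supersets and containing all cofinite subsets of $\omega$. $\mathcal{F}^+=\{X\subseteq\omega: X\cap Y\text{ infinite for all }Y\in\mathcal{F}\}$, $\mathcal{F}^c=\mathcal{P}(\omega)\setminus\mathcal{F}$. In $\mathfrak{G}(\mathcal{F},\omega,\mathcal{F})$, at each stage $k$ player I chooses $X_k\in\mathcal{F}$ and II responds with $n_k\in X_k$; II wins iff $\{n_k:k\in\omega\}\in\mathcal{F}$. In $\mathfrak{G}(\mathcal{F}^+,[\omega]^{<\omega},\mathcal{F}^c)$, I chooses $X_k\in\mathcal{F}^+$ and II responds with a nonempty finite $s_k\subseteq X_k$; II wins iff $\bigcup_k s_k\notin\mathcal{F}$. Two games are dual if for each player, that player has a winning strategy in one game iff the other player has a winning strategy in the other. An $\mathcal{F}$-tree is a tree $\mathcal{T}$ of finite sequences of natural numbers (closed under initial segments) such that for each $\bar s\in\mathcal{T}$ there is $X_{\bar s}\in\mathcal{F}$ with $\bar s^\frown n\in\mathcal{T}$ for all $n\in X_{\bar s}$; $\mathcal{F}$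 is Ramsey if every $\mathcal{F}$-tree has a branch (infinite sequence all of whose initial segments lie in $\mathcal{T}$) whose set of values lies in $\mathcal{F}$. -}

module Defs where

open import Level using (Level; 0ℓ) renaming (suc to lsuc)
open import Data.Nat using (ℕ; _≤_)
open import Data.List using (List; []; _∷_; map; upTo; _++_; _∷ʳ_)
open import Data.List.NonEmpty using (List⁺; toList)
open import Data.List.Membership.Propositional using (_∈_)
open import Data.List.Relation.Unary.All using (All)
open import Data.Product using (Σ; ∃; _×_; _,_; proj₁; proj₂)
open import Relation.Binary.PropositionalEquality using (_≡_)
open import Relation.Nullary using (¬_)
open import Function.Bundles using (_⇔_)

Subset : Set₁
Subset = ℕ → Set

_⊆_ : Subset → Subset → Set
X ⊆ Y = ∀ n → X n → Y n

_∩_ : Subset → Subset → Subset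
(X ∩ Y) n = X n × Y n

Infinite : Subset → Set
Infinite X = ∀ m → ∃ λ n → m ≤ n × X n

Cofinite : Subset → Set
Cofinite X = ∃ λ m → ∀ n → m ≤ n → X n

Family : Set₂
Family = Subset → Set₁

record IsFilter (F : Family) : Set₁ where
  field
    ∩-closed  : ∀ X Y → F X → F Y → F (X ∩ Y)
    ⊆-closed  : ∀ X Y → X ⊆ Y → F X → F Y
    cofinite  : ∀ X → Cofinite X → F X

_⁺ : Family → Family
(F ⁺) X = ∀ Y → F Y → Infinite (X ∩ Y)

_ᶜ : Family → Family
(F ᶜ) X = ¬ F X

range : (ℕ → ℕ) → Subset
range f m = ∃ λ k → f k ≡ m

prefix : {A : Set₁} → (ℕ → A) → ℕ → List A
prefix f k = map f (upTo k)

prefix₀ : {A : Set} → (ℕ → A) → ℕ → List A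
prefix₀ f k = map f (upTo k)

-- The game 𝔊(F, ω, F): I plays X_k ∈ F, II plays n_k ∈ X_k;
-- II wins iff {n_k} ∈ F.

Move₁ : Family → Set₁
Move₁ F = Σ Subset F

-- A strategy for I sees II's previous moves (I's own moves are determined).
StratI₁ : Family → Set₁
StratI₁ F = List ℕ → Move₁ F

StratII₁ : Family → Set₁
StratII₁ F = (hist : List (Move₁ F)) → (X : Move₁ F) → Σ ℕ (proj₁ X)

IWins₁ : (F : Family) → Set₁
IWins₁ F = Σ (StratI₁ F) λ σ →
  ∀ (n : ℕ → ℕ) → (∀ k → proj₁ (σ (prefix₀ n k)) (n k)) → ¬ F (range n)

IIWins₁ : (F : Family) → Set₁
IIWins₁ F = Σ (StratII₁ F) λ ρ →
  ∀ (X : ℕ → Move₁ F) → F (range (λ k → proj₁ (ρ (prefix X k) (X k))))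

-- The game 𝔊(F⁺, [ω]^{<ω}, F^c): I plays X_k ∈ F⁺, II plays a nonempty
-- finite s_k ⊆ X_k; II wins iff ⋃ s_k ∉ F.

Move₂ : Family → Set₁
Move₂ F = Σ Subset (F ⁺)

-- nonempty finite subsets of ω represented by nonempty lists
Fin⁺ : Set
Fin⁺ = List⁺ ℕ

_⊆ₗ_ : Fin⁺ → Subset → Set
s ⊆ₗ X = All X (toList s)

⋃ : (ℕ → Fin⁺) → Subset
⋃ s m = ∃ λ k → m ∈ toList (s k)

StratI₂ : Family → Set₁
StratI₂ F = List Fin⁺ → Move₂ F

StratII₂ : Family → Set₁
StratII₂ F = (hist : List (Move₂ F)) → (X : Move₂ F) → Σ Fin⁺ (λ s → s ⊆ₗ proj₁ X)

IWins₂ : (F : Family) → Set₁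
IWins₂ F = Σ (StratI₂ F) λ τ →
  ∀ (s : ℕ → Fin⁺) → (∀ k → s k ⊆ₗ proj₁ (τ (prefix₀ s k))) → F (⋃ s)

IIWins₂ : (F : Family) → Set₁
IIWins₂ F = Σ (StratII₂ F) λ ρ →
  ∀ (X : ℕ → Move₂ F) → ¬ F (⋃ (λ k → proj₁ (ρ (prefix X k) (X k))))

record IsFTree (F : Family) (T : List ℕ → Set) : Set₁ where
  field
    root      : T []
    init-closed : ∀ s t → T (s ++ t) → T s
    splitting : ∀ s → T s → Σ Subset λ X → F X × (∀ n → X n → T (s ∷ʳ n))

IsBranch : (List ℕ → Set) → (ℕ → ℕ) → Set
IsBranch T b = ∀ k → T (prefix₀ b k)

Ramsey : Family → Set₁
Ramsey F = ∀ (T : List ℕ → Set) → IsFTree F T →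
  Σ (ℕ → ℕ) λ b → IsBranch T b × F (range b)

Dual₂₁ : Family → Set₁
Dual₂₁ F = (IWins₂ F ⇔ IIWins₁ F) × (IIWins₂ F ⇔ IWins₁ F)

-- A strategy for I in either game becomes one for II in the other by
-- shadowing: a set in F⁺ meets every set in F, so II can always answer with
-- a (singleton of a) point of I's move that I's strategy in the other game
-- also allows.  II never wins 𝔊(F,ω,F): let II's strategy play two games in
-- which I always moves above the other game's last answer; the two ranges
-- interleave, so they are disjoint sets in F, whence ∅ ∈ F, which II cannot
-- answer.  Strategies of I in 𝔊(F,ω,F) correspond to F-trees (the tree of
-- legal plays; conversely, "play the splitting set"), and such a strategy
-- wins exactly when its tree has no branch with range in F.  The converse of
-- the duality is classical: against a winning strategy ρ of II in the second
-- game, I plays the set of numbers ρ could answer at the current position,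
-- which is in F since otherwise I could play its complement.
module Submission where

open import Defs
open import Level using (0ℓ; suc)
open import Data.Product using (_×_)
open import Relation.Nullary using (¬_)
open import Function.Bundles using (_⇔_)
open import Axiom.ExcludedMiddle using (ExcludedMiddle)

open import Data.Nat using (ℕ; zero; _<_; _≤′_; _<′_; ≤′-refl; ≤′-step; _≤?_)
open import Data.Nat.Properties using (<-trans; <-irrefl; ≤⇒≤′; ≰⇒>)
open import Data.List using (List; []; _∷_; map; upTo; foldl; _++_; _∷ʳ_; [_])
open import Data.List.Properties using (upTo-∷ʳ; map-++; foldl-∷ʳ; ++-assoc; ++-identityʳ)
open import Data.List.NonEmpty using (toList) renaming ([_] to [_]⁺)
open import Data.List.Relation.Unary.All using ([]; _∷_) renaming (head to All-head)
open import Data.List.Relation.Unary.Any using (here)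
open import Data.List.Membership.Propositional using (_∈_)
open import Data.Product using (Σ; _,_; proj₁; proj₂)
open import Data.Unit using (⊤; tt)
open import Data.Empty using (⊥; ⊥-elim)
open import Function using (id)
open import Relation.Nullary using (Dec; yes; no)
open import Relation.Nullary.Decidable using (True; toWitness; fromWitness)
open import Axiom.DoubleNegationElimination using (em⇒dne)
open import Relation.Binary.PropositionalEquality
  using (_≡_; _≢_; refl; sym; trans; cong; subst; module ≡-Reasoning)
open import Function.Bundles using (mk⇔)

module _ {a} {A : Set a} where

  prefix-suc : (f : ℕ → A) (k : ℕ) → map f (upTo (ℕ.suc k)) ≡ map f (upTo k) ∷ʳ f k
  prefix-suc f k = trans (cong (map f) (sym (upTo-∷ʳ k))) (map-++ f (upTo k) [ k ])

  snoc-chain≡prefix : (h : ℕ → List A) (f : ℕ → A) → h 0 ≡ [] →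
                      (∀ k → h (ℕ.suc k) ≡ h k ∷ʳ f k) → ∀ k → h k ≡ map f (upTo k)
  snoc-chain≡prefix h f h₀ step zero = h₀
  snoc-chain≡prefix h f h₀ step (ℕ.suc k) = begin
    h (ℕ.suc k)                ≡⟨ step k ⟩
    h k ∷ʳ f k                 ≡⟨ cong (_∷ʳ f k) (snoc-chain≡prefix h f h₀ step k) ⟩
    map f (upTo k) ∷ʳ f k      ≡⟨ sym (prefix-suc f k) ⟩
    map f (upTo (ℕ.suc k))     ∎
    where open ≡-Reasoning

module _ {a b} {A : Set a} {B : Set b} (g : List B → A → B) where

  replay : List A → List B
  replay = foldl (λ bs x → bs ∷ʳ g bs x) []

  replay-prefix : (X : ℕ → A) (k : ℕ) →
                  replay (map X (upTo k)) ≡ map (λ j → g (replay (map X (upTo j))) (X j)) (upTo k)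
  replay-prefix X = snoc-chain≡prefix (λ k → replay (map X (upTo k))) _ refl λ k →
    trans (cong replay (prefix-suc X k)) (foldl-∷ʳ _ [] (X k) (map X (upTo k)))

module _ {a b : ℕ → ℕ} (aₖ<bₖ : ∀ k → a k < b k)
         (bₖ<aₖ₊₁ : ∀ k → b k < a (ℕ.suc k)) where

  private
    a<b : ∀ {i j} → i ≤′ j → a i < b j
    a<b ≤′-refl = aₖ<bₖ _
    a<b (≤′-step i≤j) = <-trans (a<b i≤j) (<-trans (bₖ<aₖ₊₁ _) (aₖ<bₖ _))

    b<a : ∀ {i j} → j <′ i → b j < a i
    b<a ≤′-refl = bₖ<aₖ₊₁ _
    b<a (≤′-step j<i) = <-trans (b<a j<i) (<-trans (aₖ<bₖ _) (bₖ<aₖ₊₁ _))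

  interleaved-disjoint : ∀ i j → a i ≢ b j
  interleaved-disjoint i j aᵢ≡bⱼ with i ≤? j
  ... | yes i≤j = <-irrefl aᵢ≡bⱼ (a<b (≤⇒≤′ i≤j))
  ... | no  i≰j = <-irrefl (sym aᵢ≡bⱼ) (b<a (≤⇒≤′ (≰⇒> i≰j)))

range-cong : {f g : ℕ → ℕ} → (∀ k → f k ≡ g k) → range f ⊆ range g
range-cong f≗g m (k , fk≡m) = k , trans (sym (f≗g k)) fk≡m

⋃-singletons⊆range : (f : ℕ → ℕ) → ⋃ (λ k → [ f k ]⁺) ⊆ range f
⋃-singletons⊆range f m (k , here m≡fk) = k , sym m≡fk

-- S acc is the move of I's strategy in the other game after II has played acc
-- there; shadow h is that mirrored play, with each answer n embedded as emb n.
module Shadow {M : Set₁} (set : M → Subset) {A : Set} (emb : ℕ → A) (S : List A → Subset)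
              (common : ∀ acc x → Σ ℕ λ n → set x n × S acc n) where

  shadow : List M → List A
  shadow = replay λ acc x → emb (proj₁ (common acc x))

  strategy : (h : List M) (x : M) → Σ ℕ (set x)
  strategy h x = let n , xn , _ = common (shadow h) x in n , xn

  answers : (ℕ → M) → ℕ → ℕ
  answers X k = proj₁ (strategy (prefix X k) (X k))

  answers-legal : ∀ X k → S (prefix₀ (λ j → emb (answers X j)) k) (answers X k)
  answers-legal X k = subst (λ acc → S acc (answers X k)) (replay-prefix _ X k)
                            (proj₂ (proj₂ (common (shadow (prefix X k)) (X k))))

∁ : Subset → Subset
∁ X n = ¬ X n

module FilterGames (F : Family) (isF : IsFilter F) where
  open IsFilter isF

  IWins₁⇒IIWins₂ : IWins₁ F → IIWins₂ F
  IWins₁⇒IIWins₂ (σ , σ-wins) = ρ , λ X F⋃ →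
    σ-wins (answers X) (answers-legal X) (⊆-closed _ _ (⋃-singletons⊆range (answers X)) F⋃)
    where
    common : ∀ acc (X : Move₂ F) → Σ ℕ λ n → proj₁ X n × proj₁ (σ acc) n
    common acc (X , X∈F⁺) = let n , _ , Xn , σn = X∈F⁺ _ (proj₂ (σ acc)) 0 in n , Xn , σn
    open Shadow proj₁ id (λ acc → proj₁ (σ acc)) common
    ρ : StratII₂ F
    ρ h X = let n , Xn = strategy h X in [ n ]⁺ , Xn ∷ []

  IWins₂⇒IIWins₁ : IWins₂ F → IIWins₁ F
  IWins₂⇒IIWins₁ (τ , τ-wins) = strategy , λ X →
    ⊆-closed _ _ (⋃-singletons⊆range (answers X)) (τ-wins _ λ k → answers-legal X k ∷ [])
    where
    common : ∀ acc (X : Move₁ F) → Σ ℕ λ n → proj₁ X n × proj₁ (τ acc) n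
    common acc (X , X∈F) = let n , _ , τn , Xn = proj₂ (τ acc) X X∈F 0 in n , Xn , τn
    open Shadow proj₁ [_]⁺ (λ acc → proj₁ (τ acc)) common

  above : ℕ → Move₁ F
  above m = (m <_) , cofinite _ (ℕ.suc m , λ _ m<n → m<n)

  ¬IIWins₁ : ¬ IIWins₁ F
  ¬IIWins₁ (ρ , ρ-wins) = proj₂ (ρ [] ((λ _ → ⊥) , ∅∈F))
    where
    reply : List (Move₁ F) → ℕ → ℕ
    reply h m = proj₁ (ρ h (above m))

    record Round : Set₁ where
      constructor round
      field
        historyA historyB : List (Move₁ F)
        bound : ℕ
    open Round

    replyA replyB : Round → ℕ
    replyA r = reply (historyA r) (bound r)
    replyB r = reply (historyB r) (replyA r)

    rounds : ℕ → Round
    rounds zero = round [] [] 0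
    rounds (ℕ.suc k) = let r = rounds k in
      round (historyA r ∷ʳ above (bound r)) (historyB r ∷ʳ above (replyA r)) (replyB r)

    a b : ℕ → ℕ
    a k = replyA (rounds k)
    b k = replyB (rounds k)

    movesA movesB : ℕ → Move₁ F
    movesA k = above (bound (rounds k))
    movesB k = above (a k)

    replies∈F : (moves : ℕ → Move₁ F) (history : Round → List (Move₁ F)) →
                (∀ k → history (rounds k) ≡ prefix moves k) →
                F (range (λ k → proj₁ (ρ (history (rounds k)) (moves k))))
    replies∈F moves history history≡ = ⊆-closed _ _
      (range-cong λ k → cong (λ h → proj₁ (ρ h (moves k))) (sym (history≡ k))) (ρ-wins moves)

    ∅∈F : F (λ _ → ⊥)
    ∅∈F = ⊆-closed _ _
      (λ { _ ((i , aᵢ≡m) , (j , bⱼ≡m)) →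
           interleaved-disjoint (λ k → proj₂ (ρ (historyB (rounds k)) (movesB k)))
                                (λ k → proj₂ (ρ (historyA (rounds (ℕ.suc k))) (movesA (ℕ.suc k))))
                                i j (trans aᵢ≡m (sym bⱼ≡m)) })
      (∩-closed _ _
        (replies∈F movesA historyA (snoc-chain≡prefix _ movesA refl λ _ → refl))
        (replies∈F movesB historyB (snoc-chain≡prefix _ movesB refl λ _ → refl)))

  ¬IWins₂ : ¬ IWins₂ F
  ¬IWins₂ w = ¬IIWins₁ (IWins₂⇒IIWins₁ w)

  module _ (σ : StratI₁ F) where

    Legal : List ℕ → List ℕ → Set
    Legal acc [] = ⊤
    Legal acc (n ∷ s) = proj₁ (σ acc) n × Legal (acc ∷ʳ n) s

    Legal-++⁻ : ∀ acc s t → Legal acc (s ++ t) → Legal acc s × Legal (acc ++ s) t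
    Legal-++⁻ acc [] t l = tt , subst (λ acc′ → Legal acc′ t) (sym (++-identityʳ acc)) l
    Legal-++⁻ acc (n ∷ s) t (σn , l) =
      let ls , lt = Legal-++⁻ (acc ∷ʳ n) s t l
      in (σn , ls) , subst (λ acc′ → Legal acc′ t) (++-assoc acc [ n ] s) lt

    Legal-++⁺ : ∀ acc s t → Legal acc s → Legal (acc ++ s) t → Legal acc (s ++ t)
    Legal-++⁺ acc [] t _ lt = subst (λ acc′ → Legal acc′ t) (++-identityʳ acc) lt
    Legal-++⁺ acc (n ∷ s) t (σn , ls) lt =
      σn , Legal-++⁺ (acc ∷ʳ n) s t ls
                     (subst (λ acc′ → Legal acc′ t) (sym (++-assoc acc [ n ] s)) lt)

    legalTree : IsFTree F (Legal [])
    legalTree = record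
      { root = tt
      ; init-closed = λ s t l → proj₁ (Legal-++⁻ [] s t l)
      ; splitting = λ s l → proj₁ (σ s) , proj₂ (σ s) , λ n σn → Legal-++⁺ [] s [ n ] l (σn , tt)
      }

    branch⇒legal : ∀ b → IsBranch (Legal []) b → ∀ k → proj₁ (σ (prefix₀ b k)) (b k)
    branch⇒legal b b∈T k =
      let b∈T′ = subst (Legal []) (prefix-suc b k) (b∈T (ℕ.suc k))
      in proj₁ (proj₂ (Legal-++⁻ [] (prefix₀ b k) [ b k ] b∈T′))

  IWins₁⇒¬Ramsey : IWins₁ F → ¬ Ramsey F
  IWins₁⇒¬Ramsey (σ , σ-wins) R =
    let b , b∈T , Fb = R _ (legalTree σ) in σ-wins b (branch⇒legal σ b b∈T) Fb

  module Classical (lem₀ : ExcludedMiddle 0ℓ) (lem₁ : ExcludedMiddle (suc 0ℓ)) where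

    ∉⇒∁∈⁺ : ∀ {X} → ¬ F X → (F ⁺) (∁ X)
    ∉⇒∁∈⁺ {X} X∉F Y Y∈F m = em⇒dne lem₀ λ ¬∃ →
      X∉F (⊆-closed _ _ (λ n (Yn , m≤n) → em⇒dne lem₀ λ ¬Xn → ¬∃ (n , m≤n , ¬Xn , Yn))
                        (∩-closed _ _ Y∈F (cofinite _ (m , λ _ m≤n → m≤n))))

    ¬Ramsey⇒branchless : ¬ Ramsey F →
      Σ (List ℕ → Set) λ T → IsFTree F T × (∀ b → IsBranch T b → ¬ F (range b))
    ¬Ramsey⇒branchless ¬R = em⇒dne lem₁ λ ¬∃T → ¬R λ T T-tree →
      em⇒dne lem₁ λ ¬∃b → ¬∃T (T , T-tree , λ b b∈T Fb → ¬∃b (b , b∈T , Fb))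

    module _ {T : List ℕ → Set} (T-tree : IsFTree F T) where
      open IsFTree T-tree

      follow : ∀ s → Dec (T s) → Move₁ F
      follow s (yes s∈T) = let X , X∈F , _ = splitting s s∈T in X , X∈F
      follow s (no _) = (λ _ → ⊤) , cofinite _ (0 , λ _ _ → tt)

      follow-grows : ∀ s n (d : Dec (T s)) → T s → proj₁ (follow s d) n → T (s ∷ʳ n)
      follow-grows s n (yes s∈T) _ Xn = proj₂ (proj₂ (splitting s s∈T)) n Xn
      follow-grows s n (no s∉T) s∈T _ = ⊥-elim (s∉T s∈T)

      treeStrategy : StratI₁ F
      treeStrategy s = follow s lem₀

      legal⇒branch : ∀ b → (∀ k → proj₁ (treeStrategy (prefix₀ b k)) (b k)) → IsBranch T b
      legal⇒branch b legal zero = root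
      legal⇒branch b legal (ℕ.suc k) =
        subst T (sym (prefix-suc b k)) (follow-grows _ _ lem₀ (legal⇒branch b legal k) (legal k))

    ¬Ramsey⇒IWins₁ : ¬ Ramsey F → IWins₁ F
    ¬Ramsey⇒IWins₁ ¬R =
      let T , T-tree , branchless = ¬Ramsey⇒branchless ¬R
      in treeStrategy T-tree , λ b legal → branchless b (legal⇒branch T-tree b legal)

    IIWins₂⇒IWins₁ : IIWins₂ F → IWins₁ F
    IIWins₂⇒IWins₁ (ρ , ρ-wins) = σ , σ-wins
      where
      Possible : List (Move₂ F) → ℕ → Set₁
      Possible h n = Σ (Move₂ F) λ X → n ∈ toList (proj₁ (ρ h X))

      Answerable : List (Move₂ F) → Subset
      Answerable h n = True (lem₁ {Possible h n})

      Answerable∈F : ∀ h → F (Answerable h)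
      Answerable∈F h = em⇒dne lem₁ λ ∉F →
        let C = ∁ (Answerable h) , ∉⇒∁∈⁺ ∉F
            s , s⊆C = ρ h C
        in All-head s⊆C (fromWitness (C , here refl))

      extend : ∀ {h n} → Dec (Possible h n) → List (Move₂ F)
      extend {h} (yes (X , _)) = h ∷ʳ X
      extend {h} (no _) = h

      extend-witness : ∀ {h n} (d : Dec (Possible h n)) (t : True d) →
                       extend d ≡ h ∷ʳ proj₁ (toWitness t)
      extend-witness (yes _) _ = refl

      history : List ℕ → List (Move₂ F)
      history = foldl (λ h n → extend (lem₁ {Possible h n})) []

      σ : StratI₁ F
      σ s = Answerable (history s) , Answerable∈F (history s)

      σ-wins : ∀ n → (∀ k → proj₁ (σ (prefix₀ n k)) (n k)) → ¬ F (range n)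
      σ-wins n legal Fn = ρ-wins X (⊆-closed _ _ range⊆⋃ Fn)
        where
        X : ℕ → Move₂ F
        X k = proj₁ (toWitness (legal k))

        history-prefix : ∀ k → history (prefix₀ n k) ≡ prefix X k
        history-prefix = snoc-chain≡prefix (λ k → history (prefix₀ n k)) X refl λ k →
          trans (cong history (prefix-suc n k))
                (trans (foldl-∷ʳ _ [] (n k) (prefix₀ n k)) (extend-witness lem₁ (legal k)))

        range⊆⋃ : range n ⊆ ⋃ (λ k → proj₁ (ρ (prefix X k) (X k)))
        range⊆⋃ m (k , refl) = k , subst (λ h → n k ∈ toList (proj₁ (ρ h (X k))))
                                         (history-prefix k) (proj₂ (toWitness (legal k)))

theorem2p21 : ExcludedMiddle 0ℓ → ExcludedMiddle (suc 0ℓ) →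
    (F : Family) → IsFilter F →
      Dual₂₁ F × (¬ IWins₂ F) × (IIWins₂ F ⇔ (¬ Ramsey F))
theorem2p21 lem₀ lem₁ F isF =
    ( mk⇔ (λ w → ⊥-elim (¬IWins₂ w)) (λ w → ⊥-elim (¬IIWins₁ w))
    , mk⇔ IIWins₂⇒IWins₁ IWins₁⇒IIWins₂ )
  , ¬IWins₂
  , mk⇔ (λ w → IWins₁⇒¬Ramsey (IIWins₂⇒IWins₁ w))
        (λ ¬R → IWins₁⇒IIWins₂ (¬Ramsey⇒IWins₁ ¬R))
  where
  open FilterGames F isF
  open Classical lem₀ lem₁
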